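{- Let $n\ge1$, let $S\subseteq\mathbb{Z}_{2^n}$, and let $a$ be an integer with $1\le a\le n$. Then $|C(a+,a,a)|\ge\max\{|S_a|(|S_{a+}|-|L_a|+|S_a|),\ |S_{a+}|(2|S_a|-|L_a|),\ 0\}$.
   Context: $\mathbb{Z}_{2^n}$ is the cyclic group of integers modulo $2^n$. For $1\le i\le n$, $L_i=\{x\in\mathbb{Z}_{2^n}: x\equiv 2^{i-1}\pmod{2^i}\}$ and $L_{n+1}=\{0\}$. Set $S_i=S\cap L_i$ and $S_{a+}=S\cap(L_{a+1}\cup L_{a+2}\cup\dots\cup L_{n+1})$. Define $C(a+,a,a)=\{(x,y,z)\in S^3: x+y=z,\ x\in S_{a+},\ y\in S_a,\ z\in S_a\}$ (addition modulo $2^n$). -}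

module Defs where

open import Data.Bool using (Bool; true; false; _∧_; _∨_; if_then_else_)
open import Data.Nat using (ℕ; zero; suc; _+_; _*_; _^_; _∸_; _≤ᵇ_; _≡ᵇ_)
open import Data.Nat.DivMod using (_%_)
open import Data.Nat.Properties using (m^n≢0)
open import Data.Fin using (Fin; toℕ)
open import Data.Fin.Subset using (Subset)
open import Data.Vec using (lookup)
open import Data.List using (List; length; filterᵇ; cartesianProduct; map; upTo)
open import Data.Bool.ListAction using (any)
open import Data.List using () renaming (allFin to allFinL)
open import Data.Product using (_×_; _,_)

ℤ₂ : ℕ → Set
ℤ₂ n = Fin (2 ^ n)

-- Decidable membership x ∈ L_i (as a Bool), for 1 ≤ i ≤ n+1:
--   L_i = { x : x ≡ 2^(i-1) (mod 2^i) } for 1 ≤ i ≤ n,  L_{n+1} = {0}.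
-- For indices outside [1, n+1] the level is empty.
inL : (n i : ℕ) → ℤ₂ n → Bool
inL n zero x = false
inL n (suc j) x =
  if suc j ≤ᵇ n
  then ((toℕ x % (2 ^ suc j)) {{m^n≢0 2 (suc j)}}) ≡ᵇ ((2 ^ j) % (2 ^ suc j)) {{m^n≢0 2 (suc j)}}
  else (if suc j ≡ᵇ suc n then toℕ x ≡ᵇ 0 else false)

-- x ∈ L_{a+1} ∪ L_{a+2} ∪ ... ∪ L_{n+1}
inLplus : (n a : ℕ) → ℤ₂ n → Bool
inLplus n a x = any (λ k → inL n (a + suc k) x) (upTo ((suc n) ∸ a))

elems : (n : ℕ) → List (ℤ₂ n)
elems n = allFinL (2 ^ n)

cardL : (n i : ℕ) → ℕ
cardL n i = length (filterᵇ (inL n i) (elems n))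

cardS : (n : ℕ) → Subset (2 ^ n) → ℕ → ℕ
cardS n S i = length (filterᵇ (λ x → lookup S x ∧ inL n i x) (elems n))

cardSplus : (n : ℕ) → Subset (2 ^ n) → ℕ → ℕ
cardSplus n S a = length (filterᵇ (λ x → lookup S x ∧ inLplus n a x) (elems n))

addMod : (n : ℕ) → ℤ₂ n → ℤ₂ n → ℕ
addMod n x y = ((toℕ x + toℕ y) % (2 ^ n)) {{m^n≢0 2 n}}

inC : (n : ℕ) → Subset (2 ^ n) → ℕ → ℤ₂ n × ℤ₂ n × ℤ₂ n → Bool
inC n S a (x , y , z) =
  lookup S x ∧ lookup S y ∧ lookup S z
  ∧ (addMod n x y ≡ᵇ toℕ z)
  ∧ inLplus n a x ∧ inL n a y ∧ inL n a z

triples : (n : ℕ) → List (ℤ₂ n × ℤ₂ n × ℤ₂ n)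
triples n = cartesianProduct (elems n) (cartesianProduct (elems n) (elems n))

cardC : (n : ℕ) → Subset (2 ^ n) → ℕ → ℕ
cardC n S a = length (filterᵇ (inC n S a) (triples n))

module Submission where

-- Write N = 2ⁿ and count C(a+,a,a) as pairs (x, y) with x ∈ S_{a+}, y ∈ S_a and
-- x + y ∈ S_a (the third coordinate is forced to be z = x + y).  Two facts about
-- levels drive the argument: every element of S_{a+} is divisible by 2^a, and
-- membership in L_a only depends on the residue modulo 2^a; hence translating by
-- an element of S_{a+} maps L_a onto itself.  Translations of ℤ/N are
-- permutations, so they preserve cardinalities, and inclusion–exclusion inside
-- L_a gives
--   * for fixed x ∈ S_{a+}: #{y ∈ S_a : x + y ∈ S_a}  ≥ 2|S_a| − |L_a|,
--   * for fixed y ∈ S_a:    #{x ∈ S_{a+} : x + y ∈ S_a} ≥ |S_{a+}| + |S_a| − |L_a|.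
-- Summing over the rows, resp. columns, yields the two bounds of the theorem.

open import Defs
open import Data.Nat using (ℕ; _≤_)
open import Data.Fin.Subset using (Subset)
open import Data.Integer using (ℤ; +_; _-_; _*_; _⊔_) renaming (_≤_ to _≤ℤ_; _+_ to _+ℤ_)

open import Data.Nat.Properties
  using (+-*-semiring; +-comm; +-assoc; <⇒≤; +-identityʳ; *-identityˡ; +-mono-≤; ≤-refl; ≤-reflexive; m<m+n; m≤n+m; m+[n∸m]≡n;
         m+n∸n≡m; m≤n⇒m≤1+n; m^n≢0; ^-distribˡ-+-*; ≤⇒≤ᵇ; ≡ᵇ⇒≡; module ≤-Reasoning)
open import Algebra.Properties.Semiring.Sum +-*-semiring
  using (sum; sum-syntax; sum-cong-≗; ∑-distrib-+; ∑-comm; *-distribʳ-sum; ∑-permute; sum-replicate-zero)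
open import Data.Bool.Properties using (∧-idempotentCommutativeMonoid)
open import Algebra.Solver.IdempotentCommutativeMonoid ∧-idempotentCommutativeMonoid
  using (solve; _⊜_) renaming (_⊕_ to _∧ᵉ_)
open import Data.Bool using (Bool; true; false; _∧_; T; T?)
open import Data.Empty using (⊥-elim)
open import Data.Fin using (Fin; toℕ; fromℕ<)
import Data.Fin as Fin
open import Data.Fin.Permutation using (permutation)
open import Data.Fin.Properties using (toℕ-fromℕ<; toℕ-injective; toℕ<n)
import Data.Integer.Properties as ℤ
open import Data.Integer.Base using (_⊖_; +≤+)
open import Data.Integer.Tactic.RingSolver using (solve-∀)
open import Data.List using (List; []; _∷_; _++_; map; length; filterᵇ; tabulate; cartesianProduct; allFin; upTo)
open import Data.List.Properties using (filter-++; length-++)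
open import Data.List.Relation.Unary.Any using (satisfied)
open import Data.List.Relation.Unary.Any.Properties using (any⁻)
open import Data.Nat using (zero; suc; _+_; _^_; _∸_; _<_; _≤ᵇ_; _≡ᵇ_; z≤n; s≤s; NonZero)
  renaming (_*_ to _·_)
open import Data.Nat.DivMod using (_%_; m%n<n; m%n%n≡m%n; %-distribˡ-+; [m+n]%n≡m%n; m<n⇒m%n≡m; m∣n⇒o%n%m≡o%m; m*n%n≡0)
open import Data.Nat.Divisibility using (_∣_; m∣m*n; n∣m⇒m%n≡0)
open import Data.Product using (_×_; _,_)
open import Data.Unit using (tt)
open import Data.Vec using (lookup)
open import Function using (_∘_)
open import Relation.Binary.PropositionalEquality using (_≡_; refl; sym; trans; cong; cong₂; subst; subst₂; module ≡-Reasoning)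


ind : Bool → ℕ
ind true  = 1
ind false = 0

count : ∀ {N} → (Fin N → Bool) → ℕ
count {N} p = ∑[ i < N ] ind (p i)

sum-mono : ∀ {N} {f g : Fin N → ℕ} → (∀ i → f i ≤ g i) → sum f ≤ sum g
sum-mono {zero}  f≤g = z≤n
sum-mono {suc N} f≤g = +-mono-≤ (f≤g Fin.zero) (sum-mono (f≤g ∘ Fin.suc))

sum-delta : ∀ {N} (k : Fin N) (c : Fin N → Bool) → ∑[ z < N ] ind ((toℕ k ≡ᵇ toℕ z) ∧ c z) ≡ ind (c k)
sum-delta {suc N} Fin.zero    c = trans (cong (_+_ (ind (c Fin.zero))) (sum-replicate-zero N)) (+-identityʳ _)
sum-delta {suc N} (Fin.suc k) c = sum-delta k (c ∘ Fin.suc)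

ind-incl-excl : ∀ p q r → (T p → T r) → (T q → T r) → ind p + ind q ≤ ind (p ∧ q) + ind r
ind-incl-excl true  q     true  _    _    = ≤-reflexive (+-comm 1 (ind q))
ind-incl-excl true  q     false p⊆r _    = ⊥-elim (p⊆r tt)
ind-incl-excl false true  true  _    _    = ≤-refl
ind-incl-excl false true  false _    q⊆r = ⊥-elim (q⊆r tt)
ind-incl-excl false false r     _    _    = z≤n

count-incl-excl : ∀ {N} (P Q R : Fin N → Bool) → (∀ i → T (P i) → T (R i)) → (∀ i → T (Q i) → T (R i)) →
  count P + count Q ≤ count (λ i → P i ∧ Q i) + count R
count-incl-excl P Q R P⊆R Q⊆R = begin
  count P + count Q                                    ≡⟨ ∑-distrib-+ (ind ∘ P) (ind ∘ Q) ⟨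
  sum (λ i → ind (P i) + ind (Q i))                    ≤⟨ sum-mono (λ i → ind-incl-excl (P i) (Q i) (R i) (P⊆R i) (Q⊆R i)) ⟩
  sum (λ i → ind (P i ∧ Q i) + ind (R i))              ≡⟨ ∑-distrib-+ (λ i → ind (P i ∧ Q i)) (ind ∘ R) ⟩
  count (λ i → P i ∧ Q i) + count R                    ∎
  where open ≤-Reasoning

row-bound : ∀ {M} b (q : Fin M → Bool) c l → (T b → c ≤ count q + l) →
  ind b · c ≤ count (λ j → b ∧ q j) + ind b · l
row-bound true  q c l row rewrite *-identityˡ c | *-identityˡ l = row tt
row-bound false q c l _   = z≤n

double-count : ∀ {N M} (w : Fin N → Bool) (q : Fin N → Fin M → Bool) c l →
  (∀ i → T (w i) → c ≤ count (q i) + l) →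
  count w · c ≤ ∑[ i < N ] count (λ j → w i ∧ q i j) + count w · l
double-count {N} w q c l rows = begin
  count w · c                                                ≡⟨ *-distribʳ-sum c (ind ∘ w) ⟩
  ∑[ i < N ] (ind (w i) · c)                                 ≤⟨ sum-mono (λ i → row-bound (w i) (q i) c l (rows i)) ⟩
  ∑[ i < N ] (count (λ j → w i ∧ q i j) + ind (w i) · l)    ≡⟨ ∑-distrib-+ (λ i → count (λ j → w i ∧ q i j)) (λ i → ind (w i) · l) ⟩
  ∑[ i < N ] count (λ j → w i ∧ q i j) + ∑[ i < N ] (ind (w i) · l)
                                                             ≡⟨ cong (_+_ _) (*-distribʳ-sum l (ind ∘ w)) ⟨
  ∑[ i < N ] count (λ j → w i ∧ q i j) + count w · l        ∎
  where open ≤-Reasoning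

%-absorbˡ : ∀ m k N .{{_ : NonZero N}} → (m % N + k) % N ≡ (m + k) % N
%-absorbˡ m k N = begin
  (m % N + k) % N          ≡⟨ %-distribˡ-+ (m % N) k N ⟩
  (m % N % N + k % N) % N  ≡⟨ cong (λ r → (r + k % N) % N) (m%n%n≡m%n m N) ⟩
  (m % N + k % N) % N      ≡⟨ %-distribˡ-+ m k N ⟨
  (m + k) % N              ∎
  where open ≡-Reasoning

module Cyclic (N : ℕ) .{{_ : NonZero N}} where

  shift : ℕ → Fin N → Fin N
  shift c x = fromℕ< (m%n<n (toℕ x + c) N)

  toℕ-shift : ∀ c x → toℕ (shift c x) ≡ (toℕ x + c) % N
  toℕ-shift c x = toℕ-fromℕ< (m%n<n (toℕ x + c) N)

  shift-cancel : ∀ c d → d + c ≡ N → ∀ x → shift c (shift d x) ≡ x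
  shift-cancel c d d+c≡N x = toℕ-injective (begin
    toℕ (shift c (shift d x))    ≡⟨ toℕ-shift c (shift d x) ⟩
    (toℕ (shift d x) + c) % N    ≡⟨ cong (λ m → (m + c) % N) (toℕ-shift d x) ⟩
    ((toℕ x + d) % N + c) % N    ≡⟨ %-absorbˡ (toℕ x + d) c N ⟩
    (toℕ x + d + c) % N          ≡⟨ cong (_% N) (trans (+-assoc (toℕ x) d c) (cong (_+_ (toℕ x)) d+c≡N)) ⟩
    (toℕ x + N) % N              ≡⟨ [m+n]%n≡m%n (toℕ x) N ⟩
    toℕ x % N                    ≡⟨ m<n⇒m%n≡m (toℕ<n x) ⟩
    toℕ x                        ∎)
    where open ≡-Reasoning

  _⊕_ : Fin N → Fin N → Fin N
  x ⊕ y = shift (toℕ y) x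

  ⊕-comm : ∀ x y → x ⊕ y ≡ y ⊕ x
  ⊕-comm x y = toℕ-injective (begin
    toℕ (x ⊕ y)          ≡⟨ toℕ-shift (toℕ y) x ⟩
    (toℕ x + toℕ y) % N  ≡⟨ cong (_% N) (+-comm (toℕ x) (toℕ y)) ⟩
    (toℕ y + toℕ x) % N  ≡⟨ toℕ-shift (toℕ x) y ⟨
    toℕ (y ⊕ x)          ∎)
    where open ≡-Reasoning

  sum-translate : ∀ (f : Fin N → ℕ) y → ∑[ x < N ] f (x ⊕ y) ≡ sum f
  sum-translate f y = sym (∑-permute f (permutation (shift c) (shift d) (shift-cancel c d d+c≡N) (shift-cancel d c c+d≡N)))
    where
    c d : ℕ
    c = toℕ y
    d = N ∸ toℕ y
    c+d≡N : c + d ≡ N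
    c+d≡N = m+[n∸m]≡n (<⇒≤ (toℕ<n y))
    d+c≡N : d + c ≡ N
    d+c≡N = trans (+-comm d c) c+d≡N

  count-translateʳ : ∀ (p : Fin N → Bool) y → count (λ x → p (x ⊕ y)) ≡ count p
  count-translateʳ p y = sum-translate (ind ∘ p) y

  count-translateˡ : ∀ (p : Fin N → Bool) x → count (λ y → p (x ⊕ y)) ≡ count p
  count-translateˡ p x = trans (sum-cong-≗ (λ y → cong (ind ∘ p) (⊕-comm x y))) (count-translateʳ p x)

length-filterᵇ-++ : ∀ {A : Set} (p : A → Bool) (xs ys : List A) →
  length (filterᵇ p (xs ++ ys)) ≡ length (filterᵇ p xs) + length (filterᵇ p ys)
length-filterᵇ-++ p xs ys = trans (cong length (filter-++ (T? ∘ p) xs ys)) (length-++ (filterᵇ p xs))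

length-filterᵇ-map : ∀ {A B : Set} (p : B → Bool) (f : A → B) (xs : List A) →
  length (filterᵇ p (map f xs)) ≡ length (filterᵇ (p ∘ f) xs)
length-filterᵇ-map p f []       = refl
length-filterᵇ-map p f (x ∷ xs) with p (f x)
... | true  = cong suc (length-filterᵇ-map p f xs)
... | false = length-filterᵇ-map p f xs

length-filterᵇ-tabulate : ∀ {N} {A : Set} (p : A → Bool) (f : Fin N → A) →
  length (filterᵇ p (tabulate f)) ≡ count (p ∘ f)
length-filterᵇ-tabulate {zero}  p f = refl
length-filterᵇ-tabulate {suc N} p f with p (f Fin.zero)
... | true  = cong suc (length-filterᵇ-tabulate p (f ∘ Fin.suc))
... | false = length-filterᵇ-tabulate p (f ∘ Fin.suc)

length-filterᵇ-cartesian : ∀ {N} {A B : Set} (p : A × B → Bool) (f : Fin N → A) (ys : List B) →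
  length (filterᵇ p (cartesianProduct (tabulate f) ys)) ≡ ∑[ i < N ] length (filterᵇ (λ y → p (f i , y)) ys)
length-filterᵇ-cartesian {zero}  p f ys = refl
length-filterᵇ-cartesian {suc N} p f ys = begin
  length (filterᵇ p (map (f Fin.zero ,_) ys ++ cartesianProduct (tabulate (f ∘ Fin.suc)) ys))
    ≡⟨ length-filterᵇ-++ p (map (f Fin.zero ,_) ys) (cartesianProduct (tabulate (f ∘ Fin.suc)) ys) ⟩
  length (filterᵇ p (map (f Fin.zero ,_) ys)) + length (filterᵇ p (cartesianProduct (tabulate (f ∘ Fin.suc)) ys))
    ≡⟨ cong₂ _+_ (length-filterᵇ-map p (f Fin.zero ,_) ys) (length-filterᵇ-cartesian p (f ∘ Fin.suc) ys) ⟩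
  ∑[ i < suc N ] length (filterᵇ (λ y → p (f i , y)) ys) ∎
  where open ≡-Reasoning

length-filterᵇ-allFin : ∀ {N} (p : Fin N → Bool) → length (filterᵇ p (allFin N)) ≡ count p
length-filterᵇ-allFin p = length-filterᵇ-tabulate p (λ i → i)

-- The residue of m modulo 2^k (the instance argument spelled out as in the definitions).
infixl 7 _mod2^_
_mod2^_ : ℕ → ℕ → ℕ
m mod2^ k = (m % 2 ^ k) {{m^n≢0 2 k}}

^-∣ : ∀ m {a b} → a ≤ b → m ^ a ∣ m ^ b
^-∣ m {a} {b} a≤b = subst (m ^ a ∣_) (trans (sym (^-distribˡ-+-* m a (b ∸ a))) (cong (m ^_) (m+[n∸m]≡n a≤b)))
                      (m∣m*n (m ^ (b ∸ a)))

inL-residue : ∀ {n j} → suc j ≤ n → (x : ℤ₂ n) →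
  inL n (suc j) x ≡ (toℕ x mod2^ suc j ≡ᵇ 2 ^ j mod2^ suc j)
inL-residue {n} {j} a≤n x with suc j ≤ᵇ n | ≤⇒≤ᵇ a≤n
... | true | _ = refl

congruent-divisible : ∀ M P .{{_ : NonZero M}} .{{_ : NonZero P}} → M ∣ P → ∀ {x h} → M ∣ h →
  x % P ≡ h % P → x % M ≡ 0
congruent-divisible M P M∣P {x} {h} M∣h x≡h = begin
  x % M            ≡⟨ m∣n⇒o%n%m≡o%m M P x M∣P ⟨
  x % P % M        ≡⟨ cong (_% M) x≡h ⟩
  h % P % M        ≡⟨ m∣n⇒o%n%m≡o%m M P h M∣P ⟩
  h % M            ≡⟨ n∣m⇒m%n≡0 h M M∣h ⟩
  0                ∎
  where open ≡-Reasoning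

level-divisible : ∀ {n a t} (x : ℤ₂ n) → a < t → T (inL n t x) → toℕ x mod2^ a ≡ 0
level-divisible {n} {a} {suc j} x (s≤s a≤j) x∈Lt with suc j ≤ᵇ n
... | true = congruent-divisible (2 ^ a) (2 ^ suc j) {{m^n≢0 2 a}} {{m^n≢0 2 (suc j)}}
               (^-∣ 2 (m≤n⇒m≤1+n a≤j)) (^-∣ 2 a≤j) (≡ᵇ⇒≡ _ _ x∈Lt)
... | false with suc j ≡ᵇ suc n
...   | true  rewrite ≡ᵇ⇒≡ (toℕ x) 0 x∈Lt = m*n%n≡0 0 (2 ^ a) {{m^n≢0 2 a}}
...   | false = ⊥-elim x∈Lt

inLplus-divisible : ∀ {n} a (x : ℤ₂ n) → T (inLplus n a x) → toℕ x mod2^ a ≡ 0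
inLplus-divisible {n} a x x∈L+ with satisfied (any⁻ (λ k → inL n (a + suc k) x) (upTo (suc n ∸ a)) x∈L+)
... | k , x∈L = level-divisible x (m<m+n a (s≤s z≤n)) x∈L

residue-translate : ∀ M N .{{_ : NonZero M}} .{{_ : NonZero N}} → M ∣ N → ∀ x y → x % M ≡ 0 →
  (x + y) % N % M ≡ y % M
residue-translate M N M∣N x y x≡0 = begin
  (x + y) % N % M          ≡⟨ m∣n⇒o%n%m≡o%m M N (x + y) M∣N ⟩
  (x + y) % M              ≡⟨ %-distribˡ-+ x y M ⟩
  (x % M + y % M) % M      ≡⟨ cong (λ r → (r + y % M) % M) x≡0 ⟩
  y % M % M                ≡⟨ m%n%n≡m%n y M ⟩
  y % M                    ∎
  where open ≡-Reasoning

inC-regroup : ∀ sx sy sz e px ly lz →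
  sx ∧ sy ∧ sz ∧ e ∧ px ∧ ly ∧ lz ≡ e ∧ ((sx ∧ px) ∧ ((sy ∧ ly) ∧ (sz ∧ lz)))
inC-regroup = solve 7 (λ sx sy sz e px ly lz →
  sx ∧ᵉ sy ∧ᵉ sz ∧ᵉ e ∧ᵉ px ∧ᵉ ly ∧ᵉ lz ⊜ e ∧ᵉ ((sx ∧ᵉ px) ∧ᵉ ((sy ∧ᵉ ly) ∧ᵉ (sz ∧ᵉ lz)))) refl

∧-swap : ∀ p q r → p ∧ (q ∧ r) ≡ q ∧ (p ∧ r)
∧-swap = solve 3 (λ p q r → p ∧ᵉ (q ∧ᵉ r) ⊜ q ∧ᵉ (p ∧ᵉ r)) refl

∧-elimʳ : ∀ p q → T (p ∧ q) → T q
∧-elimʳ true q t = t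

module Bounds (n j : ℕ) (a≤n : suc j ≤ n) (S : Subset (2 ^ n)) where

  private instance
    2ⁿ-nonZero : NonZero (2 ^ n)
    2ⁿ-nonZero = m^n≢0 2 n

  open Cyclic (2 ^ n)

  a : ℕ
  a = suc j

  Sₐ₊ Sₐ Lₐ : ℤ₂ n → Bool
  Sₐ₊ x = lookup S x ∧ inLplus n a x
  Sₐ  x = lookup S x ∧ inL n a x
  Lₐ  x = inL n a x

  inL-translate : ∀ x y → T (Sₐ₊ x) → Lₐ (x ⊕ y) ≡ Lₐ y
  inL-translate x y x∈Sₐ₊ = begin
    Lₐ (x ⊕ y)                                         ≡⟨ inL-residue a≤n (x ⊕ y) ⟩
    (toℕ (x ⊕ y) mod2^ a ≡ᵇ 2 ^ j mod2^ a)             ≡⟨ cong (λ r → r mod2^ a ≡ᵇ 2 ^ j mod2^ a) (toℕ-shift (toℕ y) x) ⟩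
    (addMod n x y mod2^ a ≡ᵇ 2 ^ j mod2^ a)            ≡⟨ cong (_≡ᵇ 2 ^ j mod2^ a) x+y≡y ⟩
    (toℕ y mod2^ a ≡ᵇ 2 ^ j mod2^ a)                   ≡⟨ inL-residue a≤n y ⟨
    Lₐ y                                                ∎
    where
    open ≡-Reasoning
    x+y≡y : addMod n x y mod2^ a ≡ toℕ y mod2^ a
    x+y≡y = residue-translate (2 ^ a) (2 ^ n) {{m^n≢0 2 a}} (^-∣ 2 a≤n) (toℕ x) (toℕ y)
              (inLplus-divisible a x (∧-elimʳ _ _ x∈Sₐ₊))

  cardS≡ : cardS n S a ≡ count Sₐ
  cardS≡ = length-filterᵇ-allFin Sₐ

  cardSplus≡ : cardSplus n S a ≡ count Sₐ₊
  cardSplus≡ = length-filterᵇ-allFin Sₐ₊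

  cardL≡ : cardL n a ≡ count Lₐ
  cardL≡ = length-filterᵇ-allFin Lₐ

  completions : ∀ x y → ∑[ z < 2 ^ n ] ind (inC n S a (x , y , z)) ≡ ind (Sₐ₊ x ∧ (Sₐ y ∧ Sₐ (x ⊕ y)))
  completions x y = trans (sum-cong-≗ (λ z → cong ind (regroup z)))
                          (sum-delta (x ⊕ y) (λ z → Sₐ₊ x ∧ (Sₐ y ∧ Sₐ z)))
    where
    regroup : ∀ z → inC n S a (x , y , z) ≡ (toℕ (x ⊕ y) ≡ᵇ toℕ z) ∧ (Sₐ₊ x ∧ (Sₐ y ∧ Sₐ z))
    regroup z = trans (inC-regroup (lookup S x) (lookup S y) (lookup S z) (addMod n x y ≡ᵇ toℕ z)
                                   (inLplus n a x) (inL n a y) (inL n a z))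
                      (cong (λ m → (m ≡ᵇ toℕ z) ∧ (Sₐ₊ x ∧ (Sₐ y ∧ Sₐ z))) (sym (toℕ-shift (toℕ y) x)))

  cardC-rows : cardC n S a ≡ ∑[ x < 2 ^ n ] count (λ y → Sₐ₊ x ∧ (Sₐ y ∧ Sₐ (x ⊕ y)))
  cardC-rows = begin
    cardC n S a
      ≡⟨ length-filterᵇ-cartesian (inC n S a) (λ x → x) (cartesianProduct (elems n) (elems n)) ⟩
    ∑[ x < 2 ^ n ] length (filterᵇ (λ yz → inC n S a (x , yz)) (cartesianProduct (elems n) (elems n)))
      ≡⟨ sum-cong-≗ (λ x → length-filterᵇ-cartesian (λ yz → inC n S a (x , yz)) (λ y → y) (elems n)) ⟩
    ∑[ x < 2 ^ n ] ∑[ y < 2 ^ n ] length (filterᵇ (λ z → inC n S a (x , y , z)) (elems n))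
      ≡⟨ sum-cong-≗ (λ x → sum-cong-≗ (λ y → length-filterᵇ-allFin (λ z → inC n S a (x , y , z)))) ⟩
    ∑[ x < 2 ^ n ] ∑[ y < 2 ^ n ] ∑[ z < 2 ^ n ] ind (inC n S a (x , y , z))
      ≡⟨ sum-cong-≗ (λ x → sum-cong-≗ (completions x)) ⟩
    ∑[ x < 2 ^ n ] count (λ y → Sₐ₊ x ∧ (Sₐ y ∧ Sₐ (x ⊕ y))) ∎
    where open ≡-Reasoning

  cardC-columns : cardC n S a ≡ ∑[ y < 2 ^ n ] count (λ x → Sₐ y ∧ (Sₐ₊ x ∧ Sₐ (x ⊕ y)))
  cardC-columns = trans cardC-rows (trans (∑-comm (λ x y → ind (Sₐ₊ x ∧ (Sₐ y ∧ Sₐ (x ⊕ y)))))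
    (sum-cong-≗ (λ y → sum-cong-≗ (λ x → cong ind (∧-swap (Sₐ₊ x) (Sₐ y) (Sₐ (x ⊕ y)))))))

  -- A row x ∈ S_{a+}: S_a and its translate S_a − x both lie in L_a.
  row-count : ∀ x → T (Sₐ₊ x) → count Sₐ + count Sₐ ≤ count (λ y → Sₐ y ∧ Sₐ (x ⊕ y)) + count Lₐ
  row-count x x∈Sₐ₊ = subst (λ m → count Sₐ + m ≤ count (λ y → Sₐ y ∧ Sₐ (x ⊕ y)) + count Lₐ)
    (count-translateˡ Sₐ x)
    (count-incl-excl Sₐ (λ y → Sₐ (x ⊕ y)) Lₐ
      (λ y → ∧-elimʳ (lookup S y) (Lₐ y))
      (λ y x⊕y∈Sₐ → subst T (inL-translate x y x∈Sₐ₊) (∧-elimʳ _ _ x⊕y∈Sₐ)))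

  -- A column y ∈ S_a: S_{a+} and S_a − y both lie in the translate L_a − y.
  column-count : ∀ y → T (Sₐ y) → count Sₐ₊ + count Sₐ ≤ count (λ x → Sₐ₊ x ∧ Sₐ (x ⊕ y)) + count Lₐ
  column-count y y∈Sₐ = subst₂ (λ m l → count Sₐ₊ + m ≤ count (λ x → Sₐ₊ x ∧ Sₐ (x ⊕ y)) + l)
    (count-translateʳ Sₐ y) (count-translateʳ Lₐ y)
    (count-incl-excl Sₐ₊ (λ x → Sₐ (x ⊕ y)) (λ x → Lₐ (x ⊕ y))
      (λ x x∈Sₐ₊ → subst T (sym (inL-translate x y x∈Sₐ₊)) (∧-elimʳ _ _ y∈Sₐ))
      (λ x → ∧-elimʳ (lookup S (x ⊕ y)) (Lₐ (x ⊕ y))))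

  bound-rows : cardSplus n S a · (cardS n S a + cardS n S a) ≤ cardC n S a + cardSplus n S a · cardL n a
  bound-rows rewrite cardS≡ | cardSplus≡ | cardL≡ | cardC-rows =
    double-count Sₐ₊ (λ x y → Sₐ y ∧ Sₐ (x ⊕ y)) (count Sₐ + count Sₐ) (count Lₐ) row-count

  bound-columns : cardS n S a · (cardSplus n S a + cardS n S a) ≤ cardC n S a + cardS n S a · cardL n a
  bound-columns rewrite cardS≡ | cardSplus≡ | cardL≡ | cardC-columns =
    double-count Sₐ (λ y x → Sₐ₊ x ∧ Sₐ (x ⊕ y)) (count Sₐ₊ + count Sₐ) (count Lₐ) column-count

lift-bound : ∀ a b c d → a · b ≤ c + a · d → + a * (+ b - + d) ≤ℤ + c
lift-bound a b c d ab≤c+ad = begin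
  + a * (+ b - + d)              ≡⟨ distrib (+ a) (+ b) (+ d) ⟩
  + a * + b - + a * + d          ≡⟨ cong₂ _-_ (ℤ.pos-* a b) (ℤ.pos-* a d) ⟨
  + (a · b) - + (a · d)          ≡⟨ ℤ.m-n≡m⊖n (a · b) (a · d) ⟩
  (a · b) ⊖ (a · d)              ≤⟨ ℤ.⊖-monoˡ-≤ (a · d) ab≤c+ad ⟩
  (c + a · d) ⊖ (a · d)          ≡⟨ ℤ.≤-⊖ (m≤n+m (a · d) c) ⟩
  + (c + a · d ∸ a · d)          ≡⟨ cong +_ (m+n∸n≡m c (a · d)) ⟩
  + c                            ∎
  where
  open ℤ.≤-Reasoning
  distrib : ∀ (x y z : ℤ) → x * (y - z) ≡ x * y - x * z
  distrib = solve-∀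

claim4p3 : (n : ℕ) → 1 ≤ n → (S : Subset (2 Data.Nat.^ n)) → (a : ℕ) → 1 ≤ a → a ≤ n →
    ((+ cardS n S a) * (+ cardSplus n S a - + cardL n a +ℤ + cardS n S a))
      ⊔ ((+ cardSplus n S a) * ((+ 2) * (+ cardS n S a) - + cardL n a))
      ⊔ (+ 0)
      ≤ℤ + cardC n S a
claim4p3 n _ S (suc j) _ a≤n = ℤ.⊔-lub (ℤ.⊔-lub first second) (+≤+ z≤n)
  where
  open Bounds n j a≤n S using (bound-rows; bound-columns)
  sₐ₊ sₐ lₐ c : ℕ
  sₐ₊ = cardSplus n S (suc j)
  sₐ  = cardS n S (suc j)
  lₐ  = cardL n (suc j)
  c   = cardC n S (suc j)
  regroup₁ : ∀ (p l s : ℤ) → p - l +ℤ s ≡ (p +ℤ s) - l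
  regroup₁ = solve-∀
  regroup₂ : ∀ (l s : ℤ) → (+ 2) * s - l ≡ (s +ℤ s) - l
  regroup₂ = solve-∀
  first : + sₐ * (+ sₐ₊ - + lₐ +ℤ + sₐ) ≤ℤ + c
  first rewrite regroup₁ (+ sₐ₊) (+ lₐ) (+ sₐ) = lift-bound sₐ (sₐ₊ + sₐ) c lₐ bound-columns
  second : + sₐ₊ * ((+ 2) * (+ sₐ) - + lₐ) ≤ℤ + c
  second rewrite regroup₂ (+ lₐ) (+ sₐ) = lift-bound sₐ₊ (sₐ + sₐ) c lₐ bound-rows
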